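{- Let $d,q,n,k$ be integers with $q\ge 2d$, $n\ge1$ and $k\ge2$. Then $\alpha(C_{d,q}^n)\le B^{L_\infty}_k(q,n,d)$.
   Context: For integers $d,q$ with $q\ge2d$, the circular graph $C_{d,q}$ has vertex set $\mathbb{Z}_q$, with two distinct vertices adjacent iff their distance mod $q$ (i.e. $\min\{|a-b|,q-|a-b|\}$) is strictly less than $d$. For a graph $G=(V,E)$, $G^n$ is the strong product power: vertex set $V^n$, with distinct $(u_1,\dots,u_n),(v_1,\dots,v_n)$ adjacent iff for every $i$ either $u_i=v_i$ or $u_iv_i\in E$. $\alpha(\cdot)$ denotes the maximum size of an independent set. For distinct $u,v\in\mathbb{Z}_q^n$, their Lee$_\infty$-distance $d_{L_\infty}(u,v)$ is the maximum over $i$ of the distance of $u_i$ and $v_i$ mod $q$. For $S\subseteq\mathbb{Z}_q^n$, $d^{L_\infty}_{\min}(S)$ is the minimum of $d_{L_\infty}$ over pairs of distinct elements of $S$, and $\infty$ if $|S|\le1$. Let $\mathcal{C}_k$ be the collection of all $C\subseteq\mathbb{Z}_q^n$ with $|C|\le k$ (including $\emptyset$). For $D\in\mathcal{C}_k$ let $\mathcal{C}_k(D)=\{C\in\mathcal{C}_k : C\supseteq D,\ |D|+2|C\setminus D|\le k\}$, and for $x:\mathcal{C}_k\to\mathbb{R}$ let $M_{k,D}(x)$ be the $\mathcal{C}_k(D)\times\mathcal{C}_k(D)$ matrix with entries $x(C\cup C')$. Define $B^{L_\infty}_k(q,n,d)=\max\{\sum_{v\in\mathbb{Z}_q^n}x(\{v\})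 : x:\mathcal{C}_k\to\mathbb{R},\ x(\emptyset)=1,\ x(S)=0\text{ whenever } d^{L_\infty}_{\min}(S)<d,\ M_{k,D}(x)\text{ positive semidefinite for each } D\in\mathcal{C}_k\}$. -}

module Defs where

open import Data.Nat using (ℕ; zero; suc; _+_; _*_; _∸_; _^_; _≤_; _<_; _⊔_; _⊓_; ∣_-_∣; _≤?_)
open import Data.Fin using (Fin; toℕ)
open import Data.Fin.Base using (remQuot)
open import Data.Fin.Subset using (Subset; _∈_; _⊆_; _∪_; _─_; ∣_∣; ⁅_⁆)
open import Data.Fin.Subset.Properties using (_⊆?_)
open import Data.Vec using (Vec; []; _∷_; lookup)
open import Data.List using (List; []; _∷_; map; _++_; foldr; filter)
open import Data.List.Base using (allFin)
open import Data.Bool using (true; false)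
open import Data.Product using (Σ; _×_; _,_; proj₁; proj₂)
open import Data.Sum using (_⊎_)
open import Relation.Nullary using (¬_; Dec)
open import Relation.Nullary.Decidable using (_×-dec_)
open import Relation.Binary.PropositionalEquality using (_≡_; _≢_)
open import Data.Integer using (+_)
open import Data.Rational using (ℚ; 0ℚ; _/_) renaming (_+_ to _+ℚ_; _*_ to _*ℚ_; _≤_ to _≤ℚ_)

-- Points of ℤ_q^n.  We identify ℤ_q with Fin q (residues 0..q-1) and
-- encode the q^n points of ℤ_q^n by Fin (q ^ n) (mixed-radix digits),
-- so that subsets of ℤ_q^n are 'Subset (q ^ n)'.

Point : ℕ → ℕ → Set
Point q n = Fin (q ^ n)

coords : ∀ {q} n → Point q n → Vec (Fin q) n
coords zero    _ = []
coords {q} (suc n) a = proj₁ (remQuot {q} (q ^ n) a) ∷ coords n (proj₂ (remQuot {q} (q ^ n) a))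

coord : ∀ q n → Point q n → Fin n → Fin q
coord q n a i = lookup (coords n a) i

cdist : ∀ {q} → Fin q → Fin q → ℕ
cdist {q} a b = ∣ toℕ a - toℕ b ∣ ⊓ (q ∸ ∣ toℕ a - toℕ b ∣)

CAdj : ℕ → ∀ {q} → Fin q → Fin q → Set
CAdj d a b = a ≢ b × cdist a b < d

StrongAdj : ℕ → ∀ q n → Point q n → Point q n → Set
StrongAdj d q n u v =
  coords n u ≢ coords n v ×
  ((i : Fin n) → (coord q n u i ≡ coord q n v i) ⊎ CAdj d (coord q n u i) (coord q n v i))

IndependentSet : ℕ → ∀ q n → Subset (q ^ n) → Set
IndependentSet d q n S = ∀ u v → u ∈ S → v ∈ S → ¬ StrongAdj d q n u v

maxOver : ∀ {n} → (Fin n → ℕ) → ℕ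
maxOver {n} f = foldr _⊔_ 0 (map f (allFin n))

dLinf : ∀ q n → Point q n → Point q n → ℕ
dLinf q n u v = maxOver (λ i → cdist (coord q n u i) (coord q n v i))

-- d_min^{L∞}(S) < d  (for |S| ≤ 1 the minimum distance is ∞, never < d)
DminLt : ∀ q n → Subset (q ^ n) → ℕ → Set
DminLt q n S d =
  Σ (Point q n) λ u → Σ (Point q n) λ v →
    u ∈ S × v ∈ S × coords n u ≢ coords n v × dLinf q n u v < d

sumℚ : List ℚ → ℚ
sumℚ = foldr _+ℚ_ 0ℚ

ℕtoℚ : ℕ → ℚ
ℕtoℚ m = (+ m) / 1

allSubsets : ∀ m → List (Subset m)
allSubsets zero    = [] ∷ []
allSubsets (suc m) = map (true ∷_) (allSubsets m) ++ map (false ∷_) (allSubsets m)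

-- The Lasserre-type bound B_k^{L∞}(q,n,d)
-- x is a function on all subsets of ℤ_q^n; only its values on 𝒞_k matter.

idxSet : ∀ {N} → ℕ → Subset N → List (Subset N)
idxSet {N} k D = filter (λ C → (D ⊆? C) ×-dec ((∣ D ∣ + 2 * ∣ C ─ D ∣) ≤? k)) (allSubsets N)

-- M_{k,D}(x) is positive semidefinite: z^T M z ≥ 0 for every vector z
-- (indexed by 𝒞_k(D); entries M(C,C') = x(C ∪ C'))
PSD-M : ∀ {N} → ℕ → (Subset N → ℚ) → Subset N → Set
PSD-M {N} k x D = (z : Subset N → ℚ) →
  0ℚ ≤ℚ sumℚ (map (λ C → sumℚ (map (λ C' → (z C *ℚ z C') *ℚ x (C ∪ C')) (idxSet k D))) (idxSet k D))

Feasible : ∀ q n → ℕ → ℕ → (Subset (q ^ n) → ℚ) → Set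
Feasible q n d k x =
  (x (Data.Fin.Subset.⊥) ≡ ℕtoℚ 1) ×
  ((S : Subset (q ^ n)) → ∣ S ∣ ≤ k → DminLt q n S d → x S ≡ 0ℚ) ×
  ((D : Subset (q ^ n)) → ∣ D ∣ ≤ k → PSD-M k x D)

objective : ∀ q n → (Subset (q ^ n) → ℚ) → ℚ
objective q n x = sumℚ (map (λ v → x ⁅ v ⁆) (allFin (q ^ n)))

-- "α(C_{d,q}^n) ≤ B_k^{L∞}(q,n,d)": every independent set S has
-- |S| ≤ value of some feasible point of the program.
AlphaLeB : ℕ → ℕ → ℕ → ℕ → Set
AlphaLeB q n d k =
  (S : Subset (q ^ n)) → IndependentSet d q n S →
  Σ (Subset (q ^ n) → ℚ) λ x → Feasible q n d k x × (ℕtoℚ ∣ S ∣ ≤ℚ objective q n x)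

module Submission where

-- The bound α(C_{d,q}^n) ≤ B_k^{L∞}(q,n,d) is proved by exhibiting, for
-- every independent set S of C_{d,q}^n, a feasible point of the
-- semidefinite program whose objective value is |S|: the moment vector
--   x_S(C) = 1 if C ⊆ S,  and 0 otherwise.
-- Its three feasibility conditions hold for reasons of increasing depth:
--   * x_S(∅) = 1 since ∅ ⊆ S;
--   * x_S vanishes on every C with d_min(C) < d, because two distinct
--     points at Lee_∞-distance < d are adjacent in C_{d,q}^n, so such a C
--     cannot lie inside the independent set S;
--   * x_S is multiplicative, x_S(C ∪ C') = x_S(C) x_S(C'), and every
--     multiplicative x has positive semidefinite moment matrices, since
--     z^T M z = (Σ_C z(C) x(C))² ≥ 0.
-- Finally Σ_v x_S({v}) counts the points of S.

open import Defs
open import Data.Nat using (ℕ; _*_; _≤_; NonZero)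

open import Data.Nat as ℕ using (_<_; _⊔_)
import Data.Nat.Properties as ℕP
open import Data.Nat.Coprimality using (Coprime; 1-coprimeTo)
import Data.Nat.Coprimality as Coprimality
import Data.Integer as ℤ
import Data.Integer.Properties as ℤP
open import Data.Rational using (ℚ; 0ℚ; 1ℚ; mkℚ; _/_; nonPositive; nonNegative)
  renaming (_+_ to _+ℚ_; _*_ to _*ℚ_; _≤_ to _≤ℚ_)
import Data.Rational.Properties as ℚP
open import Data.Fin as Fin using (Fin)
open import Data.Fin.Subset using (Subset; _⊆_; _∪_; ⁅_⁆; ∣_∣)
import Data.Fin.Subset as Subset
open import Data.Fin.Subset.Properties
  using (⊆-min; _⊆?_; p⊆p∪q; q⊆p∪q; x∈p∪q⁻; x∈⁅x⁆; x∈⁅y⁆⇒x≡y)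
open import Data.Vec as Vec using (lookup)
open import Data.Vec.Properties using (lookup⇒[]=; []=⇒lookup)
open import Data.List using (List; []; _∷_; map; foldr; tabulate; allFin)
open import Data.List.Properties using (map-cong; map-tabulate)
open import Data.List.Relation.Unary.Any using (here; there)
open import Data.List.Membership.Propositional using () renaming (_∈_ to _∈ˡ_)
open import Data.List.Membership.Propositional.Properties using (∈-map⁺; ∈-allFin)
open import Data.Bool using (Bool; true; false; _∧_; T; if_then_else_)
open import Data.Bool.Properties using (T-≡)
open import Data.Product using (_×_; _,_)
open import Data.Sum using (_⊎_; inj₁; inj₂)
open import Data.Empty using (⊥-elim)
open import Relation.Nullary using (yes; no; does)
open import Relation.Nullary.Decidable using (dec-true; does-⇔; _×-dec_; T?)
open import Relation.Binary.PropositionalEquality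
open import Function using (_∘_; _⇔_; mk⇔; Equivalence)

ℕtoℚ-+ : ∀ a b → ℕtoℚ (a ℕ.+ b) ≡ ℕtoℚ a +ℚ ℕtoℚ b
ℕtoℚ-+ a b = begin
    ℕtoℚ (a ℕ.+ b)
  ≡⟨ cong (_/ 1) (sym integerSum) ⟩
    mkℚ (ℤ.+ a) 0 a/1-coprime +ℚ mkℚ (ℤ.+ b) 0 b/1-coprime
  ≡⟨ sym (cong₂ _+ℚ_ (ℚP.normalize-coprime a/1-coprime) (ℚP.normalize-coprime b/1-coprime)) ⟩
    ℕtoℚ a +ℚ ℕtoℚ b ∎
  where
  open ≡-Reasoning
  a/1-coprime : Coprime a 1
  a/1-coprime = Coprimality.sym (1-coprimeTo a)
  b/1-coprime : Coprime b 1
  b/1-coprime = Coprimality.sym (1-coprimeTo b)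
  integerSum : (ℤ.+ a) ℤ.* (ℤ.+ 1) ℤ.+ (ℤ.+ b) ℤ.* (ℤ.+ 1) ≡ ℤ.+ (a ℕ.+ b)
  integerSum = trans (cong₂ ℤ._+_ (ℤP.*-identityʳ (ℤ.+ a)) (ℤP.*-identityʳ (ℤ.+ b)))
                     (sym (ℤP.pos-+ a b))

sumℚ-*ˡ : ∀ {A : Set} (c : ℚ) (f : A → ℚ) (xs : List A) →
  sumℚ (map (λ a → c *ℚ f a) xs) ≡ c *ℚ sumℚ (map f xs)
sumℚ-*ˡ c f []       = sym (ℚP.*-zeroʳ c)
sumℚ-*ˡ c f (a ∷ xs) =
  trans (cong (c *ℚ f a +ℚ_) (sumℚ-*ˡ c f xs)) (sym (ℚP.*-distribˡ-+ c (f a) _))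

sumℚ-*ʳ : ∀ {A : Set} (c : ℚ) (f : A → ℚ) (xs : List A) →
  sumℚ (map (λ a → f a *ℚ c) xs) ≡ sumℚ (map f xs) *ℚ c
sumℚ-*ʳ c f []       = sym (ℚP.*-zeroˡ c)
sumℚ-*ʳ c f (a ∷ xs) =
  trans (cong (f a *ℚ c +ℚ_) (sumℚ-*ʳ c f xs)) (sym (ℚP.*-distribʳ-+ c (f a) _))

doubleSum-square : ∀ {A : Set} (w : A → ℚ) (xs : List A) →
  sumℚ (map (λ a → sumℚ (map (λ b → w a *ℚ w b) xs)) xs) ≡ sumℚ (map w xs) *ℚ sumℚ (map w xs)
doubleSum-square w xs = begin
    sumℚ (map (λ a → sumℚ (map (λ b → w a *ℚ w b) xs)) xs)
  ≡⟨ cong sumℚ (map-cong (λ a → sumℚ-*ˡ (w a) w xs) xs) ⟩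
    sumℚ (map (λ a → w a *ℚ sumℚ (map w xs)) xs)
  ≡⟨ sumℚ-*ʳ (sumℚ (map w xs)) w xs ⟩
    sumℚ (map w xs) *ℚ sumℚ (map w xs) ∎
  where open ≡-Reasoning

square-nonneg : ∀ p → 0ℚ ≤ℚ p *ℚ p
square-nonneg p with ℚP.≤-total 0ℚ p
... | inj₁ 0≤p = let instance _ = nonNegative 0≤p in
  subst (_≤ℚ p *ℚ p) (ℚP.*-zeroˡ p) (ℚP.*-monoʳ-≤-nonNeg p 0≤p)
... | inj₂ p≤0 = let instance _ = nonPositive p≤0 in
  subst (_≤ℚ p *ℚ p) (ℚP.*-zeroˡ p) (ℚP.*-monoʳ-≤-nonPos p p≤0)

-- If x(C ∪ C') = x(C) x(C') for all C, C', then every moment matrix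
-- M_{k,D}(x) is the rank-one matrix (x(C) x(C'))_{C,C'} restricted to
-- 𝒞_k(D), so its quadratic form is the square (Σ_C z(C) x(C))².
multiplicative⇒PSD : ∀ {N} (x : Subset N → ℚ) →
  (∀ C C' → x (C ∪ C') ≡ x C *ℚ x C') → ∀ k D → PSD-M k x D
multiplicative⇒PSD x x-∪ k D z =
  subst (0ℚ ≤ℚ_) (sym quadraticForm) (square-nonneg (sumℚ (map w 𝒞)))
  where
  open ≡-Reasoning
  𝒞 : List (Subset _)
  𝒞 = idxSet k D
  w : Subset _ → ℚ
  w C = z C *ℚ x C
  entry : ∀ C C' → (z C *ℚ z C') *ℚ x (C ∪ C') ≡ w C *ℚ w C'
  entry C C' = begin
      (z C *ℚ z C') *ℚ x (C ∪ C')
    ≡⟨ cong ((z C *ℚ z C') *ℚ_) (x-∪ C C') ⟩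
      (z C *ℚ z C') *ℚ (x C *ℚ x C')
    ≡⟨ ℚP.*-assoc (z C) (z C') _ ⟩
      z C *ℚ (z C' *ℚ (x C *ℚ x C'))
    ≡⟨ cong (z C *ℚ_) (ℚP.*-comm (z C') _) ⟩
      z C *ℚ ((x C *ℚ x C') *ℚ z C')
    ≡⟨ cong (z C *ℚ_) (ℚP.*-assoc (x C) (x C') (z C')) ⟩
      z C *ℚ (x C *ℚ (x C' *ℚ z C'))
    ≡⟨ sym (ℚP.*-assoc (z C) (x C) _) ⟩
      w C *ℚ (x C' *ℚ z C')
    ≡⟨ cong (w C *ℚ_) (ℚP.*-comm (x C') (z C')) ⟩
      w C *ℚ w C' ∎
  quadraticForm : sumℚ (map (λ C → sumℚ (map (λ C' → (z C *ℚ z C') *ℚ x (C ∪ C')) 𝒞)) 𝒞)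
                ≡ sumℚ (map w 𝒞) *ℚ sumℚ (map w 𝒞)
  quadraticForm = trans (cong sumℚ (map-cong (λ C → cong sumℚ (map-cong (entry C) 𝒞)) 𝒞))
                        (doubleSum-square w 𝒞)

𝟙 : Bool → ℚ
𝟙 b = if b then 1ℚ else 0ℚ

𝟙-∧ : ∀ a b → 𝟙 (a ∧ b) ≡ 𝟙 a *ℚ 𝟙 b
𝟙-∧ true  true  = refl
𝟙-∧ true  false = refl
𝟙-∧ false b     = sym (ℚP.*-zeroˡ (𝟙 b))

𝟙-count : ∀ {N} (S : Subset N) → sumℚ (tabulate (𝟙 ∘ lookup S)) ≡ ℕtoℚ ∣ S ∣
𝟙-count Vec.[]          = refl
𝟙-count (true Vec.∷ S)  = trans (cong (1ℚ +ℚ_) (𝟙-count S)) (sym (ℕtoℚ-+ 1 ∣ S ∣))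
𝟙-count (false Vec.∷ S) = trans (ℚP.+-identityˡ _) (𝟙-count S)

moments : ∀ {N} → Subset N → Subset N → ℚ
moments S C = 𝟙 (does (C ⊆? S))

∪-⊆-⇔ : ∀ {N} (C C' S : Subset N) → (C ∪ C' ⊆ S) ⇔ (C ⊆ S × C' ⊆ S)
∪-⊆-⇔ C C' S = mk⇔
  (λ ⊆S → (λ {v} v∈ → ⊆S (p⊆p∪q C' v∈)) , (λ {v} v∈ → ⊆S (q⊆p∪q C C' v∈)))
  least
  where
  least : C ⊆ S × C' ⊆ S → C ∪ C' ⊆ S
  least (C⊆S , C'⊆S) {v} v∈ with x∈p∪q⁻ C C' v∈
  ... | inj₁ v∈C  = C⊆S v∈C
  ... | inj₂ v∈C' = C'⊆S v∈C'

⁅⁆-⊆-⇔ : ∀ {N} (v : Fin N) (S : Subset N) → (⁅ v ⁆ ⊆ S) ⇔ T (lookup S v)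
⁅⁆-⊆-⇔ v S = mk⇔
  (λ ⊆S → Equivalence.from T-≡ ([]=⇒lookup (⊆S (x∈⁅x⁆ v))))
  (λ Sv {u} u∈ → subst (Subset._∈ S) (sym (x∈⁅y⁆⇒x≡y v u∈))
                   (lookup⇒[]= v S (Equivalence.to T-≡ Sv)))

moments-∪ : ∀ {N} (S C C' : Subset N) → moments S (C ∪ C') ≡ moments S C *ℚ moments S C'
moments-∪ S C C' = trans (cong 𝟙 (does-⇔ (∪-⊆-⇔ C C' S) (C ∪ C' ⊆? S) ((C ⊆? S) ×-dec (C' ⊆? S))))
                         (𝟙-∧ (does (C ⊆? S)) (does (C' ⊆? S)))

moments-∅ : ∀ {N} (S : Subset N) → moments S Subset.⊥ ≡ 1ℚ
moments-∅ S = cong 𝟙 (dec-true (Subset.⊥ ⊆? S) (⊆-min S))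

moments-singletons : ∀ {N} (S : Subset N) →
  sumℚ (map (λ v → moments S ⁅ v ⁆) (allFin N)) ≡ ℕtoℚ ∣ S ∣
moments-singletons {N} S = begin
    sumℚ (map (λ v → moments S ⁅ v ⁆) (allFin N))
  ≡⟨ cong sumℚ (map-cong (λ v → cong 𝟙 (does-⇔ (⁅⁆-⊆-⇔ v S) (⁅ v ⁆ ⊆? S) (T? (lookup S v))))
                         (allFin N)) ⟩
    sumℚ (map (𝟙 ∘ lookup S) (allFin N))
  ≡⟨ cong sumℚ (map-tabulate (λ v → v) (𝟙 ∘ lookup S)) ⟩
    sumℚ (tabulate (𝟙 ∘ lookup S))
  ≡⟨ 𝟙-count S ⟩
    ℕtoℚ ∣ S ∣ ∎
  where open ≡-Reasoning

≤-foldr-⊔ : ∀ {m} {ms : List ℕ} → m ∈ˡ ms → m ≤ foldr _⊔_ 0 ms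
≤-foldr-⊔ {ms = m ∷ ms} (here refl) = ℕP.m≤m⊔n m _
≤-foldr-⊔ {ms = m ∷ ms} (there m∈) = ℕP.≤-trans (≤-foldr-⊔ m∈) (ℕP.m≤n⊔m m _)

close⇒adjacent : ∀ d q n (u v : Point q n) →
  coords n u ≢ coords n v → dLinf q n u v < d → StrongAdj d q n u v
close⇒adjacent d q n u v u≢v close = u≢v , coordinateAdj
  where
  coordinateAdj : (i : Fin n) →
    (coord q n u i ≡ coord q n v i) ⊎ CAdj d (coord q n u i) (coord q n v i)
  coordinateAdj i with coord q n u i Fin.≟ coord q n v i
  ... | yes uᵢ≡vᵢ = inj₁ uᵢ≡vᵢ
  ... | no  uᵢ≢vᵢ = inj₂ (uᵢ≢vᵢ , ℕP.≤-<-trans (≤-foldr-⊔ (∈-map⁺ _ (∈-allFin i))) close)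

moments-vanish : ∀ d q n (S : Subset (q ℕ.^ n)) → IndependentSet d q n S →
  ∀ C → DminLt q n C d → moments S C ≡ 0ℚ
moments-vanish d q n S indep C (u , v , u∈C , v∈C , u≢v , close) with C ⊆? S
... | no  _   = refl
... | yes C⊆S = ⊥-elim (indep u v (C⊆S u∈C) (C⊆S v∈C) (close⇒adjacent d q n u v u≢v close))

moments-feasible : ∀ d q n k (S : Subset (q ℕ.^ n)) → IndependentSet d q n S →
  Feasible q n d k (moments S)
moments-feasible d q n k S indep =
  moments-∅ S ,
  (λ C _ → moments-vanish d q n S indep C) ,
  (λ D _ → multiplicative⇒PSD (moments S) (moments-∪ S) k D)

mainTheorem5 : (d q n k : ℕ) → 2 * d ≤ q → 1 ≤ q → 1 ≤ n → 2 ≤ k → AlphaLeB q n d k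
mainTheorem5 d q n k _ _ _ _ S indep =
  moments S ,
  moments-feasible d q n k S indep ,
  ℚP.≤-reflexive (sym (moments-singletons S))
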